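{- For all integers $p\ge1$ and $n\ge1$, $a_{n,p,10}=\sum_{s=0}^{n-1}\binom{n-1}{s}\binom{p+s-1}{s}$. Moreover $1+\sum_{n\ge1}a_{n,p,10}t^n=1+\frac{t(1-t)^{p-1}}{(1-2t)^p}$.
   Context: For a finite integer sequence $(a_1,\dots,a_i)$, $\mathrm{asc}(a_1,\dots,a_i)=|\{j:1\le j<i,\ a_j<a_{j+1}\}|$. For an integer $p\ge1$, a $p$-ascent sequence of length $n\ge1$ is a sequence $(a_1,\dots,a_n)$ of nonnegative integers with $a_1=0$ and $a_i\le p+\mathrm{asc}(a_1,\dots,a_{i-1})$ for all $2\le i\le n$. For a word $w$ over nonnegative integers, $\mathrm{red}(w)$ replaces each copy of the $i$-th smallest letter of $w$ by $i-1$. A word $u=u_1\dots u_j$ occurs in $w=w_1\dots w_n$ if there are $1\le i_1<\dots<i_j\le n$ with $\mathrm{red}(w_{i_1}\dots w_{i_j})=u$; otherwise $w$ avoids $u$. $a_{n,p,u}$ is the number of $p$-ascent sequences of length $n$ avoiding $u$. Here $u=10$. -}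

module Defs where

open import Data.Bool using (Bool; true; false; _∧_; not; if_then_else_)
open import Data.Nat using (ℕ; zero; suc; _+_; _∸_; _<ᵇ_; _≤ᵇ_; _≡ᵇ_; _<?_)
open import Data.Nat.Properties using (_≟_)
open import Data.Nat.Combinatorics using (_C_)
open import Data.List using (List; []; _∷_; _++_; [_]; map; filter; filterᵇ; length; upTo; concatMap; deduplicate)
open import Data.Bool.ListAction using (any)
open import Data.Nat.ListAction using (sum)
open import Data.List.Properties using (≡-dec)
open import Relation.Nullary.Decidable using (isYes)
open import Data.Integer as ℤ using (ℤ)

asc : List ℕ → ℕ
asc (x ∷ y ∷ r) = (if x <ᵇ y then 1 else 0) + asc (y ∷ r)
asc _           = 0

-- checks aᵢ ≤ p + asc(a₁ … aᵢ₋₁) for every remaining entry,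
-- where `pre` is the prefix already read
ascOKᵇ : ℕ → List ℕ → List ℕ → Bool
ascOKᵇ p pre []       = true
ascOKᵇ p pre (x ∷ xs) = (x ≤ᵇ p + asc pre) ∧ ascOKᵇ p (pre ++ [ x ]) xs

isPAscentᵇ : ℕ → List ℕ → Bool
isPAscentᵇ p []       = false
isPAscentᵇ p (x ∷ xs) = (x ≡ᵇ 0) ∧ ascOKᵇ p [ x ] xs

-- red(w): each copy of the i-th smallest letter of w becomes i-1,
-- i.e. letter x becomes the number of distinct letters of w below x
red : List ℕ → List ℕ
red w = map (λ x → length (deduplicate _≟_ (filter (_<? x) w))) w

subseqs : List ℕ → List (List ℕ)
subseqs []       = [] ∷ []
subseqs (x ∷ xs) = map (x ∷_) (subseqs xs) ++ subseqs xs

occursᵇ : List ℕ → List ℕ → Bool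
occursᵇ u w = any (λ s → isYes (≡-dec _≟_ (red s) u)) (subseqs w)

avoidsᵇ : List ℕ → List ℕ → Bool
avoidsᵇ u w = not (occursᵇ u w)

words : ℕ → ℕ → List (List ℕ)
words k zero    = [] ∷ []
words k (suc n) = concatMap (λ x → map (x ∷_) (words k n)) (upTo k)

-- a_{n,p,u}: every p-ascent sequence of length n has all entries
-- ≤ p + n - 2 < p + n, so it suffices to scan words over {0,…,p+n-1}.
aCount : ℕ → ℕ → List ℕ → ℕ
aCount n p u =
  length (filterᵇ (λ w → isPAscentᵇ p w ∧ avoidsᵇ u w) (words (p + n) n))

pat10 : List ℕ
pat10 = 1 ∷ 0 ∷ []

closedForm : ℕ → ℕ → ℕ
closedForm n p = sum (map (λ s → ((n ∸ 1) C s) Data.Nat.* ((p + s ∸ 1) C s)) (upTo n))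
  where import Data.Nat

FPS : Set
FPS = ℕ → ℤ

_⊕_ : FPS → FPS → FPS
(f ⊕ g) k = f k ℤ.+ g k

_⊛_ : FPS → FPS → FPS
(f ⊛ g) k = Data.List.foldr ℤ._+_ (ℤ.+ 0) (map (λ i → f i ℤ.* g (k ∸ i)) (upTo (suc k)))
  where import Data.List

_^ˢ_ : FPS → ℕ → FPS
f ^ˢ zero  = λ { zero → ℤ.+ 1 ; (suc _) → ℤ.+ 0 }
f ^ˢ suc n = f ⊛ (f ^ˢ n)

oneMinus : ℕ → FPS
oneMinus c zero          = ℤ.+ 1
oneMinus c (suc zero)    = ℤ.- (ℤ.+ c)
oneMinus c (suc (suc _)) = ℤ.+ 0

tS : FPS
tS (suc zero) = ℤ.+ 1
tS _          = ℤ.+ 0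

genFun : ℕ → FPS
genFun p zero    = ℤ.+ 1
genFun p (suc n) = ℤ.+ (aCount (suc n) p pat10)

module Submission where

open import Defs
open import Data.Nat using (ℕ; _≤_; _∸_)
open import Data.Product using (_×_)
open import Relation.Binary.PropositionalEquality using (_≡_)

-- A word avoids 10 iff it is weakly increasing, and the ascents of a weakly
-- increasing sequence are its strict increases. Hence after each entry only the
-- slack d = p + asc - (last entry) matters: repeating the entry keeps the slack,
-- raising it by j + 1 (j < d) leaves slack d - j. The number slackCount m d of
-- admissible continuations of length m thus satisfies
--   slackCount (m + 1) d = slackCount m d + Σ_{j<d} slackCount m (d - j),
-- and a_{n,p,10} = slackCount (n - 1) p. Pascal's rule together with the
-- hockey-stick identity for multiset coefficients shows that
-- Σ_s C(m,s) C(d+s-1,s) obeys the same recurrence. For the series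
-- G_d = Σ_m slackCount m d tᵐ the recurrence reads (1 - 2t) G_{d+1} = (1 - t) G_d,
-- and (1 - t) G_0 = 1, so G_p (1 - 2t)^p = (1 - t)^{p-1}; the generating function
-- is 1 + t G_p.

module Counting where
  open import Algebra.Bundles using (CommutativeMonoid)
  open import Data.Bool using (Bool; true; false; _∧_; _∨_; not; if_then_else_)
  open import Data.Bool.ListAction using (any; or)
  open import Data.Bool.Properties using (∧-identityʳ; ∧-zeroʳ; ∨-zeroʳ; ∨-assoc; ∧-assoc; ∧-commutativeMonoid; not-injective)
  open import Data.List using (List; []; _∷_; _++_; [_]; map; filter; filterᵇ; concatMap; length; null; deduplicate; applyUpTo; upTo)
  open import Data.List.Properties using (∷-injectiveˡ; length-++; filter-++; map-++; map-∘; map-cong; filter-accept; filter-reject; ≡-dec)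
  open import Data.Nat using (zero; suc; _+_; _*_; _<_; _≤?_; _<?_; _<ᵇ_; _≤ᵇ_; z<s; s<s)
  open import Data.Nat.Combinatorics using (_C_; k>n⇒nCk≡0; nCk+nC[k+1]≡[n+1]C[k+1])
  open import Data.Nat.ListAction using (sum)
  open import Data.Nat.Properties
  open import Function using (_∘_; id)
  open import Relation.Binary.PropositionalEquality using (_≢_; refl; sym; trans; cong; cong₂; subst; module ≡-Reasoning)
  open import Relation.Nullary using (yes; no; contradiction)
  open import Relation.Nullary.Decidable using (T?; isYes; isYes≗does; dec-true; dec-false)
  open import Relation.Nullary.Reflects using (det; ofʸ; ofⁿ)

  open import Algebra.Properties.CommutativeSemigroup +-commutativeSemigroup using (interchange)
  open import Algebra.Properties.CommutativeSemigroup (CommutativeMonoid.commutativeSemigroup ∧-commutativeMonoid)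
    using () renaming (interchange to ∧-interchange)

  sumBelow : ℕ → (ℕ → ℕ) → ℕ
  sumBelow zero    f = 0
  sumBelow (suc n) f = f 0 + sumBelow n (f ∘ suc)

  infix 6.6 sumBelow
  syntax sumBelow n (λ i → e) = ∑[ i < n ] e

  sumBelow-cong : ∀ n {f g} → (∀ i → i < n → f i ≡ g i) → sumBelow n f ≡ sumBelow n g
  sumBelow-cong zero    eq = refl
  sumBelow-cong (suc n) eq = cong₂ _+_ (eq 0 z<s) (sumBelow-cong n (λ i i<n → eq (suc i) (s<s i<n)))

  sumBelow-zero : ∀ n {f} → (∀ i → i < n → f i ≡ 0) → sumBelow n f ≡ 0
  sumBelow-zero zero    eq = refl
  sumBelow-zero (suc n) eq = cong₂ _+_ (eq 0 z<s) (sumBelow-zero n (λ i i<n → eq (suc i) (s<s i<n)))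

  sumBelow-+ : ∀ n f g → ∑[ i < n ] (f i + g i) ≡ sumBelow n f + sumBelow n g
  sumBelow-+ zero    f g = refl
  sumBelow-+ (suc n) f g = begin
    f 0 + g 0 + sumBelow n (λ i → f (suc i) + g (suc i))   ≡⟨ cong (f 0 + g 0 +_) (sumBelow-+ n (f ∘ suc) (g ∘ suc)) ⟩
    f 0 + g 0 + (sumBelow n (f ∘ suc) + sumBelow n (g ∘ suc)) ≡⟨ interchange (f 0) (g 0) _ _ ⟩
    f 0 + sumBelow n (f ∘ suc) + (g 0 + sumBelow n (g ∘ suc)) ∎
    where open ≡-Reasoning

  sumBelow-*ˡ : ∀ n c f → ∑[ i < n ] (c * f i) ≡ c * sumBelow n f
  sumBelow-*ˡ zero    c f = sym (*-zeroʳ c)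
  sumBelow-*ˡ (suc n) c f =
    trans (cong (c * f 0 +_) (sumBelow-*ˡ n c (f ∘ suc))) (sym (*-distribˡ-+ c (f 0) _))

  sumBelow-suc : ∀ n f → sumBelow (suc n) f ≡ sumBelow n f + f n
  sumBelow-suc zero    f = +-comm (f 0) 0
  sumBelow-suc (suc n) f = trans (cong (f 0 +_) (sumBelow-suc n (f ∘ suc))) (sym (+-assoc (f 0) _ _))

  sumBelow-swap : ∀ m n (f : ℕ → ℕ → ℕ) → ∑[ i < m ] sumBelow n (f i) ≡ ∑[ j < n ] ∑[ i < m ] f i j
  sumBelow-swap zero    n f = sym (sumBelow-zero n (λ _ _ → refl))
  sumBelow-swap (suc m) n f = trans (cong (sumBelow n (f 0) +_) (sumBelow-swap m n (f ∘ suc)))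
    (sym (sumBelow-+ n (f 0) (λ j → ∑[ i < m ] f (suc i) j)))

  sumBelow-+-split : ∀ m n f → sumBelow (m + n) f ≡ sumBelow m f + ∑[ j < n ] f (m + j)
  sumBelow-+-split zero    n f = refl
  sumBelow-+-split (suc m) n f =
    trans (cong (f 0 +_) (sumBelow-+-split m n (f ∘ suc))) (sym (+-assoc (f 0) _ _))

  sumBelow-window : ∀ n v w {f} → v + w ≤ n →
    (∀ i → i < v → f i ≡ 0) → (∀ i → v + w ≤ i → f i ≡ 0) →
    sumBelow n f ≡ ∑[ j < w ] f (v + j)
  sumBelow-window n v w {f} v+w≤n below above = begin
    sumBelow n f                                          ≡⟨ cong (λ m → sumBelow m f) n≡v+w+r ⟩
    sumBelow (v + (w + r)) f                              ≡⟨ sumBelow-+-split v (w + r) f ⟩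
    sumBelow v f + sumBelow (w + r) (λ j → f (v + j))     ≡⟨ cong₂ _+_ (sumBelow-zero v below) (sumBelow-+-split w r _) ⟩
    ∑[ j < w ] f (v + j) + ∑[ j < r ] f (v + (w + j))     ≡⟨ cong (∑[ j < w ] f (v + j) +_) (sumBelow-zero r (λ j _ → above _ outside)) ⟩
    ∑[ j < w ] f (v + j) + 0                              ≡⟨ +-identityʳ _ ⟩
    ∑[ j < w ] f (v + j)                                  ∎
    where
    open ≡-Reasoning
    r : ℕ
    r = n ∸ (v + w)
    n≡v+w+r : n ≡ v + (w + r)
    n≡v+w+r = trans (sym (m+[n∸m]≡n v+w≤n)) (+-assoc v w r)
    outside : ∀ {j} → v + w ≤ v + (w + j)
    outside {j} = +-monoʳ-≤ v (m≤m+n w j)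

  sum-applyUpTo : ∀ n (f : ℕ → ℕ) g → sum (map f (applyUpTo g n)) ≡ sumBelow n (f ∘ g)
  sum-applyUpTo zero    f g = refl
  sum-applyUpTo (suc n) f g = cong (f (g 0) +_) (sum-applyUpTo n f (g ∘ suc))

  -- Multiset coefficients and the closed form

  -- The number of size-s multisets from d kinds.
  multichoose : ℕ → ℕ → ℕ
  multichoose d s = (d + s ∸ 1) C s

  -- Classify a size-(s+1) multiset by its least element j.
  multichoose-suc : ∀ d s → multichoose d (suc s) ≡ ∑[ j < d ] multichoose (d ∸ j) s
  multichoose-suc zero    s = k>n⇒nCk≡0 {s} {suc s} ≤-refl
  multichoose-suc (suc d) s = begin
    (d + suc s) C suc s                        ≡⟨ cong (_C suc s) (+-suc d s) ⟩
    suc (d + s) C suc s                        ≡⟨ nCk+nC[k+1]≡[n+1]C[k+1] (d + s) s ⟨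
    (d + s) C s + (d + s) C suc s              ≡⟨ cong (λ m → (d + s) C s + (m ∸ 1) C suc s) (+-suc d s) ⟨
    (d + s) C s + multichoose d (suc s)        ≡⟨ cong ((d + s) C s +_) (multichoose-suc d s) ⟩
    multichoose (suc d) s + ∑[ j < d ] multichoose (d ∸ j) s ∎
    where open ≡-Reasoning

  slackCount : ℕ → ℕ → ℕ
  slackCount zero    d = 1
  slackCount (suc m) d = slackCount m d + ∑[ j < d ] slackCount m (d ∸ j)

  closedSum : ℕ → ℕ → ℕ
  closedSum m d = ∑[ s < suc m ] (m C s) * multichoose d s

  closedSum-suc : ∀ m d → closedSum (suc m) d ≡ closedSum m d + ∑[ j < d ] closedSum m (d ∸ j)
  closedSum-suc m d = begin
    closedSum (suc m) d                 ≡⟨ cong (multichoose d 0 +_) (trans (sumBelow-cong (suc m) pascal)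
                                           (sumBelow-+ (suc m) (λ s → (m C s) * multichoose d (suc s)) (λ s → (m C suc s) * multichoose d (suc s)))) ⟩
    multichoose d 0 + (raised + kept)   ≡⟨ +-comm-middle (multichoose d 0) raised kept ⟩
    multichoose d 0 + kept + raised     ≡⟨ cong₂ _+_ kept≡closedSum raised≡sum ⟩
    closedSum m d + ∑[ j < d ] closedSum m (d ∸ j) ∎
    where
    open ≡-Reasoning
    raised kept : ℕ
    raised = ∑[ s < suc m ] (m C s) * multichoose d (suc s)
    kept   = ∑[ s < suc m ] (m C suc s) * multichoose d (suc s)
    pascal : ∀ s → s < suc m →
      (suc m C suc s) * multichoose d (suc s) ≡ (m C s) * multichoose d (suc s) + (m C suc s) * multichoose d (suc s)
    pascal s _ = trans (cong (_* multichoose d (suc s)) (sym (nCk+nC[k+1]≡[n+1]C[k+1] m s)))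
                       (*-distribʳ-+ (multichoose d (suc s)) (m C s) _)
    +-comm-middle : ∀ a b c → a + (b + c) ≡ a + c + b
    +-comm-middle a b c = trans (cong (a +_) (+-comm b c)) (sym (+-assoc a c b))
    kept≡closedSum : multichoose d 0 + kept ≡ closedSum m d
    kept≡closedSum = cong (multichoose d 0 +_) (begin
      kept                                                       ≡⟨ sumBelow-suc m _ ⟩
      ∑[ s < m ] (m C suc s) * multichoose d (suc s) + (m C suc m) * multichoose d (suc m)
        ≡⟨ cong (λ c → ∑[ s < m ] (m C suc s) * multichoose d (suc s) + c * multichoose d (suc m)) (k>n⇒nCk≡0 {m} ≤-refl) ⟩
      ∑[ s < m ] (m C suc s) * multichoose d (suc s) + 0           ≡⟨ +-identityʳ _ ⟩
      ∑[ s < m ] (m C suc s) * multichoose d (suc s)               ∎)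
    raised≡sum : raised ≡ ∑[ j < d ] closedSum m (d ∸ j)
    raised≡sum = begin
      raised                                                     ≡⟨ sumBelow-cong (suc m) (λ s _ → cong ((m C s) *_) (multichoose-suc d s)) ⟩
      ∑[ s < suc m ] (m C s) * (∑[ j < d ] multichoose (d ∸ j) s) ≡⟨ sumBelow-cong (suc m) (λ s _ → sym (sumBelow-*ˡ d (m C s) (λ j → multichoose (d ∸ j) s))) ⟩
      ∑[ s < suc m ] ∑[ j < d ] (m C s) * multichoose (d ∸ j) s    ≡⟨ sumBelow-swap (suc m) d (λ s j → (m C s) * multichoose (d ∸ j) s) ⟩
      ∑[ j < d ] closedSum m (d ∸ j)                             ∎

  slackCount≡closedSum : ∀ m d → slackCount m d ≡ closedSum m d
  slackCount≡closedSum zero    d = refl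
  slackCount≡closedSum (suc m) d = trans
    (cong₂ _+_ (slackCount≡closedSum m d) (sumBelow-cong d (λ j _ → slackCount≡closedSum m (d ∸ j))))
    (sym (closedSum-suc m d))

  slackCount≡closedForm : ∀ m p → slackCount m p ≡ closedForm (suc m) p
  slackCount≡closedForm m p = trans (slackCount≡closedSum m p)
    (sym (sum-applyUpTo (suc m) (λ s → (m C s) * multichoose p s) id))

  -- Avoiding 10 means being weakly increasing

  <ᵇ-true : ∀ {m n} → m < n → (m <ᵇ n) ≡ true
  <ᵇ-true {m} {n} m<n = det (<ᵇ-reflects-< m n) (ofʸ m<n)

  <ᵇ-false : ∀ {m n} → n ≤ m → (m <ᵇ n) ≡ false
  <ᵇ-false {m} {n} n≤m = det (<ᵇ-reflects-< m n) (ofⁿ (≤⇒≯ n≤m))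

  ≤ᵇ-true : ∀ {m n} → m ≤ n → (m ≤ᵇ n) ≡ true
  ≤ᵇ-true {m} {n} m≤n = det (≤ᵇ-reflects-≤ m n) (ofʸ m≤n)

  ≤ᵇ-false : ∀ {m n} → n < m → (m ≤ᵇ n) ≡ false
  ≤ᵇ-false {m} {n} n<m = det (≤ᵇ-reflects-≤ m n) (ofⁿ (<⇒≱ n<m))

  or-++ : ∀ (xs ys : List Bool) → or (xs ++ ys) ≡ or xs ∨ or ys
  or-++ []       ys = refl
  or-++ (x ∷ xs) ys = trans (cong (x ∨_) (or-++ xs ys)) (sym (∨-assoc x (or xs) (or ys)))

  module _ {a} {A : Set a} where

    any-++ : ∀ (f : A → Bool) xs ys → any f (xs ++ ys) ≡ any f xs ∨ any f ys
    any-++ f xs ys = trans (cong or (map-++ f xs ys)) (or-++ (map f xs) (map f ys))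

    any-map : ∀ {b} {B : Set b} (f : B → Bool) (g : A → B) xs → any f (map g xs) ≡ any (f ∘ g) xs
    any-map f g xs = cong or (sym (map-∘ xs))

    any-cong : ∀ {f g : A → Bool} xs → (∀ x → f x ≡ g x) → any f xs ≡ any g xs
    any-cong xs f≗g = cong or (map-cong f≗g xs)

    any-∧ˡ : ∀ b (f : A → Bool) xs → any (λ x → b ∧ f x) xs ≡ b ∧ any f xs
    any-∧ˡ true  f xs       = refl
    any-∧ˡ false f []       = refl
    any-∧ˡ false f (x ∷ xs) = any-∧ˡ false f xs

  is10ᵇ : List ℕ → Bool
  is10ᵇ s = isYes (≡-dec _≟_ (red s) pat10)

  is10ᵇ-true : ∀ s → red s ≡ pat10 → is10ᵇ s ≡ true
  is10ᵇ-true s eq = trans (isYes≗does (≡-dec _≟_ (red s) pat10)) (dec-true (≡-dec _≟_ (red s) pat10) eq)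

  is10ᵇ-false : ∀ s → red s ≢ pat10 → is10ᵇ s ≡ false
  is10ᵇ-false s neq = trans (isYes≗does (≡-dec _≟_ (red s) pat10)) (dec-false (≡-dec _≟_ (red s) pat10) neq)

  rank : ℕ → List ℕ → ℕ
  rank x w = length (deduplicate _≟_ (filter (_<? x) w))

  is10ᵇ-pair : ∀ v y → is10ᵇ (v ∷ y ∷ []) ≡ (y <ᵇ v)
  is10ᵇ-pair v y with y <? v
  ... | yes y<v = trans (is10ᵇ-true (v ∷ y ∷ []) (cong₂ (λ a b → a ∷ b ∷ []) rank-v rank-y)) (sym (<ᵇ-true y<v))
    where
    rank-v : rank v (v ∷ y ∷ []) ≡ 1
    rank-v = cong (length ∘ deduplicate _≟_)
      (trans (filter-reject (_<? v) {v} (<-irrefl refl)) (filter-accept (_<? v) {y} {[]} y<v))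
    rank-y : rank y (v ∷ y ∷ []) ≡ 0
    rank-y = cong (length ∘ deduplicate _≟_)
      (trans (filter-reject (_<? y) {v} (<-asym y<v)) (filter-reject (_<? y) {y} {[]} (<-irrefl refl)))
  ... | no y≮v = trans (is10ᵇ-false (v ∷ y ∷ []) (λ eq → 0≢1+n (trans (sym rank-v) (∷-injectiveˡ eq)))) (sym (<ᵇ-false (≮⇒≥ y≮v)))
    where
    rank-v : rank v (v ∷ y ∷ []) ≡ 0
    rank-v = cong (length ∘ deduplicate _≟_)
      (trans (filter-reject (_<? v) {v} (<-irrefl refl)) (filter-reject (_<? v) {y} {[]} y≮v))

  is10ᵇ-∷∷ : ∀ v y s → is10ᵇ (v ∷ y ∷ s) ≡ (y <ᵇ v) ∧ null s
  is10ᵇ-∷∷ v y []      = trans (is10ᵇ-pair v y) (sym (∧-identityʳ _))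
  is10ᵇ-∷∷ v y (z ∷ s) = trans (is10ᵇ-false (v ∷ y ∷ z ∷ s) (λ ())) (sym (∧-zeroʳ _))

  any-null-subseqs : ∀ xs → any null (subseqs xs) ≡ true
  any-null-subseqs []       = refl
  any-null-subseqs (x ∷ xs) = trans (any-++ null (map (x ∷_) (subseqs xs)) (subseqs xs))
    (trans (cong (any null (map (x ∷_) (subseqs xs)) ∨_) (any-null-subseqs xs)) (∨-zeroʳ _))

  any-is10ᵇ-∷ : ∀ v xs → any (λ s → is10ᵇ (v ∷ s)) (subseqs xs) ≡ any (_<ᵇ v) xs
  any-is10ᵇ-∷ v []       = cong (_∨ false) (is10ᵇ-false [ v ] (λ ()))
  any-is10ᵇ-∷ v (y ∷ ys) = begin
    any is10ᵇ-v (map (y ∷_) (subseqs ys) ++ subseqs ys)               ≡⟨ any-++ is10ᵇ-v (map (y ∷_) (subseqs ys)) (subseqs ys) ⟩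
    any is10ᵇ-v (map (y ∷_) (subseqs ys)) ∨ any is10ᵇ-v (subseqs ys)  ≡⟨ cong₂ _∨_ starting-with-y (any-is10ᵇ-∷ v ys) ⟩
    (y <ᵇ v) ∨ any (_<ᵇ v) ys                                        ∎
    where
    open ≡-Reasoning
    is10ᵇ-v : List ℕ → Bool
    is10ᵇ-v s = is10ᵇ (v ∷ s)
    starting-with-y : any is10ᵇ-v (map (y ∷_) (subseqs ys)) ≡ (y <ᵇ v)
    starting-with-y = begin
      any is10ᵇ-v (map (y ∷_) (subseqs ys))              ≡⟨ any-map is10ᵇ-v (y ∷_) (subseqs ys) ⟩
      any (λ s → is10ᵇ (v ∷ y ∷ s)) (subseqs ys)         ≡⟨ any-cong (subseqs ys) (is10ᵇ-∷∷ v y) ⟩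
      any (λ s → (y <ᵇ v) ∧ null s) (subseqs ys)         ≡⟨ any-∧ˡ (y <ᵇ v) null (subseqs ys) ⟩
      (y <ᵇ v) ∧ any null (subseqs ys)                   ≡⟨ cong ((y <ᵇ v) ∧_) (any-null-subseqs ys) ⟩
      (y <ᵇ v) ∧ true                                    ≡⟨ ∧-identityʳ _ ⟩
      y <ᵇ v                                             ∎

  occurs10-∷ : ∀ v xs → occursᵇ pat10 (v ∷ xs) ≡ any (_<ᵇ v) xs ∨ occursᵇ pat10 xs
  occurs10-∷ v xs = trans (any-++ is10ᵇ (map (v ∷_) (subseqs xs)) (subseqs xs))
    (cong (_∨ occursᵇ pat10 xs) (trans (any-map is10ᵇ (v ∷_) (subseqs xs)) (any-is10ᵇ-∷ v xs)))

  sortedFromᵇ : ℕ → List ℕ → Bool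
  sortedFromᵇ v []       = true
  sortedFromᵇ v (x ∷ xs) = (v ≤ᵇ x) ∧ sortedFromᵇ x xs

  sortedFromᵇ-lowerBound : ∀ {v x} xs → sortedFromᵇ x xs ≡ true → v ≤ x → any (_<ᵇ v) xs ≡ false
  sortedFromᵇ-lowerBound []       _      _   = refl
  sortedFromᵇ-lowerBound {v} {x} (y ∷ ys) sorted v≤x with x ≤? y
  ... | yes x≤y = cong₂ _∨_ (<ᵇ-false v≤y) (sortedFromᵇ-lowerBound ys sorted-ys v≤y)
    where
    v≤y : v ≤ y
    v≤y = ≤-trans v≤x x≤y
    sorted-ys : sortedFromᵇ y ys ≡ true
    sorted-ys = trans (cong (_∧ sortedFromᵇ y ys) (sym (≤ᵇ-true x≤y))) sorted
  ... | no x≰y = contradiction (trans (sym sorted) (cong (_∧ sortedFromᵇ y ys) (≤ᵇ-false (≰⇒> x≰y)))) λ ()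

  avoids10-∷ : ∀ v xs → avoidsᵇ pat10 (v ∷ xs) ≡ sortedFromᵇ v xs
  avoids10-∷ v []       = cong not (occurs10-∷ v [])
  avoids10-∷ v (x ∷ xs) with v ≤? x | sortedFromᵇ x xs in sorted
  ... | no v≰x | _ rewrite occurs10-∷ v (x ∷ xs) | <ᵇ-true (≰⇒> v≰x) | ≤ᵇ-false (≰⇒> v≰x) = refl
  ... | yes v≤x | true rewrite occurs10-∷ v (x ∷ xs) | <ᵇ-false v≤x | ≤ᵇ-true v≤x
    | sortedFromᵇ-lowerBound xs sorted v≤x | not-injective (trans (avoids10-∷ x xs) sorted) = refl
  ... | yes v≤x | false rewrite occurs10-∷ v (x ∷ xs) | <ᵇ-false v≤x | ≤ᵇ-true v≤x
    | not-injective (trans (avoids10-∷ x xs) sorted) = cong not (∨-zeroʳ _)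

  -- Counting weakly increasing p-ascent sequences

  ascentBit : ℕ → ℕ → ℕ
  ascentBit v x = if v <ᵇ x then 1 else 0

  asc-∷ʳ : ∀ ys v x → asc ((ys ++ [ v ]) ++ [ x ]) ≡ asc (ys ++ [ v ]) + ascentBit v x
  asc-∷ʳ []           v x = +-identityʳ (ascentBit v x)
  asc-∷ʳ (y ∷ [])     v x = trans (cong (ascentBit y v +_) (+-identityʳ (ascentBit v x)))
                                  (cong (_+ ascentBit v x) (sym (+-identityʳ (ascentBit y v))))
  asc-∷ʳ (y ∷ z ∷ zs) v x = trans (cong (ascentBit y z +_) (asc-∷ʳ (z ∷ zs) v x)) (sym (+-assoc (ascentBit y z) _ _))

  -- withinBoundᵇ b v xs: xs may follow a prefix ending in v whose bound p + asc is b.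
  withinBoundᵇ : ℕ → ℕ → List ℕ → Bool
  withinBoundᵇ b v []       = true
  withinBoundᵇ b v (x ∷ xs) = (x ≤ᵇ b) ∧ withinBoundᵇ (b + ascentBit v x) x xs

  ascOKᵇ≡withinBoundᵇ : ∀ p ys v xs → ascOKᵇ p (ys ++ [ v ]) xs ≡ withinBoundᵇ (p + asc (ys ++ [ v ])) v xs
  ascOKᵇ≡withinBoundᵇ p ys v []       = refl
  ascOKᵇ≡withinBoundᵇ p ys v (x ∷ xs) = cong ((x ≤ᵇ p + asc (ys ++ [ v ])) ∧_) (begin
    ascOKᵇ p ((ys ++ [ v ]) ++ [ x ]) xs                          ≡⟨ ascOKᵇ≡withinBoundᵇ p (ys ++ [ v ]) x xs ⟩
    withinBoundᵇ (p + asc ((ys ++ [ v ]) ++ [ x ])) x xs         ≡⟨ cong (λ a → withinBoundᵇ (p + a) x xs) (asc-∷ʳ ys v x) ⟩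
    withinBoundᵇ (p + (asc (ys ++ [ v ]) + ascentBit v x)) x xs  ≡⟨ cong (λ b → withinBoundᵇ b x xs) (+-assoc p _ _) ⟨
    withinBoundᵇ (p + asc (ys ++ [ v ]) + ascentBit v x) x xs    ∎)
    where open ≡-Reasoning

  sortedWithinBoundᵇ : ℕ → ℕ → List ℕ → Bool
  sortedWithinBoundᵇ b v []       = true
  sortedWithinBoundᵇ b v (x ∷ xs) = (x ≤ᵇ b) ∧ (v ≤ᵇ x) ∧ sortedWithinBoundᵇ (b + ascentBit v x) x xs

  withinBoundᵇ∧sortedFromᵇ : ∀ b v xs → withinBoundᵇ b v xs ∧ sortedFromᵇ v xs ≡ sortedWithinBoundᵇ b v xs
  withinBoundᵇ∧sortedFromᵇ b v []       = refl
  withinBoundᵇ∧sortedFromᵇ b v (x ∷ xs) = begin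
    ((x ≤ᵇ b) ∧ within) ∧ ((v ≤ᵇ x) ∧ sortedFromᵇ x xs)  ≡⟨ ∧-interchange (x ≤ᵇ b) within (v ≤ᵇ x) _ ⟩
    ((x ≤ᵇ b) ∧ (v ≤ᵇ x)) ∧ (within ∧ sortedFromᵇ x xs)  ≡⟨ ∧-assoc (x ≤ᵇ b) (v ≤ᵇ x) _ ⟩
    (x ≤ᵇ b) ∧ (v ≤ᵇ x) ∧ (within ∧ sortedFromᵇ x xs)    ≡⟨ cong (λ c → (x ≤ᵇ b) ∧ (v ≤ᵇ x) ∧ c) (withinBoundᵇ∧sortedFromᵇ _ x xs) ⟩
    sortedWithinBoundᵇ b v (x ∷ xs)                      ∎
    where
    open ≡-Reasoning
    within : Bool
    within = withinBoundᵇ (b + ascentBit v x) x xs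

  pAscent∧avoids10-0∷ : ∀ p xs → isPAscentᵇ p (0 ∷ xs) ∧ avoidsᵇ pat10 (0 ∷ xs) ≡ sortedWithinBoundᵇ p 0 xs
  pAscent∧avoids10-0∷ p xs = begin
    ascOKᵇ p [ 0 ] xs ∧ avoidsᵇ pat10 (0 ∷ xs)       ≡⟨ cong₂ _∧_ (ascOKᵇ≡withinBoundᵇ p [] 0 xs) (avoids10-∷ 0 xs) ⟩
    withinBoundᵇ (p + 0) 0 xs ∧ sortedFromᵇ 0 xs    ≡⟨ cong (λ b → withinBoundᵇ b 0 xs ∧ sortedFromᵇ 0 xs) (+-identityʳ p) ⟩
    withinBoundᵇ p 0 xs ∧ sortedFromᵇ 0 xs          ≡⟨ withinBoundᵇ∧sortedFromᵇ p 0 xs ⟩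
    sortedWithinBoundᵇ p 0 xs                       ∎
    where open ≡-Reasoning

  module _ {a} {A : Set a} where

    length-filterᵇ-++ : ∀ (P : A → Bool) xs ys →
      length (filterᵇ P (xs ++ ys)) ≡ length (filterᵇ P xs) + length (filterᵇ P ys)
    length-filterᵇ-++ P xs ys = trans (cong length (filter-++ (T? ∘ P) xs ys)) (length-++ (filterᵇ P xs))

    length-filterᵇ-concatMap : ∀ {b} {B : Set b} (P : A → Bool) (f : B → List A) xs →
      length (filterᵇ P (concatMap f xs)) ≡ sum (map (λ x → length (filterᵇ P (f x))) xs)
    length-filterᵇ-concatMap P f []       = refl
    length-filterᵇ-concatMap P f (x ∷ xs) = trans (length-filterᵇ-++ P (f x) (concatMap f xs))
      (cong (length (filterᵇ P (f x)) +_) (length-filterᵇ-concatMap P f xs))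

    length-filterᵇ-map : ∀ {b} {B : Set b} (P : A → Bool) (g : B → A) xs →
      length (filterᵇ P (map g xs)) ≡ length (filterᵇ (P ∘ g) xs)
    length-filterᵇ-map P g []       = refl
    length-filterᵇ-map P g (x ∷ xs) with P (g x)
    ... | true  = cong suc (length-filterᵇ-map P g xs)
    ... | false = length-filterᵇ-map P g xs

    length-filterᵇ-cong : ∀ {P Q : A → Bool} xs → (∀ x → P x ≡ Q x) → length (filterᵇ P xs) ≡ length (filterᵇ Q xs)
    length-filterᵇ-cong {P} {Q} []       P≗Q = refl
    length-filterᵇ-cong {P} {Q} (x ∷ xs) P≗Q with P x | Q x | P≗Q x
    ... | true  | .true  | refl = cong suc (length-filterᵇ-cong xs P≗Q)
    ... | false | .false | refl = length-filterᵇ-cong xs P≗Q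

    length-filterᵇ-none : ∀ {P : A → Bool} xs → (∀ x → P x ≡ false) → length (filterᵇ P xs) ≡ 0
    length-filterᵇ-none {P} []       none = refl
    length-filterᵇ-none {P} (x ∷ xs) none with P x | none x
    ... | false | refl = length-filterᵇ-none xs none

  count : ℕ → ℕ → (List ℕ → Bool) → ℕ
  count k n P = length (filterᵇ P (words k n))

  count-cong : ∀ k n {P Q} → (∀ w → P w ≡ Q w) → count k n P ≡ count k n Q
  count-cong k n = length-filterᵇ-cong (words k n)

  count-none : ∀ k n {P} → (∀ w → P w ≡ false) → count k n P ≡ 0
  count-none k n = length-filterᵇ-none (words k n)

  count-suc : ∀ k n P → count k (suc n) P ≡ ∑[ x < k ] count k n (λ w → P (x ∷ w))
  count-suc k n P = begin
    count k (suc n) P                                                    ≡⟨ length-filterᵇ-concatMap P (λ x → map (x ∷_) (words k n)) (upTo k) ⟩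
    sum (map (λ x → length (filterᵇ P (map (x ∷_) (words k n)))) (upTo k)) ≡⟨ cong sum (map-cong (λ x → length-filterᵇ-map P (x ∷_) (words k n)) (upTo k)) ⟩
    sum (map (λ x → count k n (λ w → P (x ∷ w))) (upTo k))               ≡⟨ sum-applyUpTo k (λ x → count k n (λ w → P (x ∷ w))) id ⟩
    ∑[ x < k ] count k n (λ w → P (x ∷ w))                               ∎
    where open ≡-Reasoning

  module _ {b v y : ℕ} (w : List ℕ) where

    sortedWithinBoundᵇ-∷-below : y < v → sortedWithinBoundᵇ b v (y ∷ w) ≡ false
    sortedWithinBoundᵇ-∷-below y<v =
      trans (cong (λ c → (y ≤ᵇ b) ∧ c ∧ sortedWithinBoundᵇ (b + ascentBit v y) y w) (≤ᵇ-false y<v)) (∧-zeroʳ _)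

    sortedWithinBoundᵇ-∷-above : b < y → sortedWithinBoundᵇ b v (y ∷ w) ≡ false
    sortedWithinBoundᵇ-∷-above b<y =
      cong (λ c → c ∧ (v ≤ᵇ y) ∧ sortedWithinBoundᵇ (b + ascentBit v y) y w) (≤ᵇ-false b<y)

    sortedWithinBoundᵇ-∷-inside : v ≤ y → y ≤ b →
      sortedWithinBoundᵇ b v (y ∷ w) ≡ sortedWithinBoundᵇ (b + ascentBit v y) y w
    sortedWithinBoundᵇ-∷-inside v≤y y≤b =
      cong₂ (λ c c′ → c ∧ c′ ∧ sortedWithinBoundᵇ (b + ascentBit v y) y w) (≤ᵇ-true y≤b) (≤ᵇ-true v≤y)

  ascentBit-refl : ∀ v → ascentBit v v ≡ 0
  ascentBit-refl v = cong (if_then 1 else 0) (<ᵇ-false (≤-refl {v}))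

  ascentBit-< : ∀ {v y} → v < y → ascentBit v y ≡ 1
  ascentBit-< v<y = cong (if_then 1 else 0) (<ᵇ-true v<y)

  raised-bound : ∀ v {d j} → j ≤ d → v + d + 1 ≡ v + suc j + (d ∸ j)
  raised-bound v {d} {j} j≤d = begin
    v + d + 1              ≡⟨ +-comm (v + d) 1 ⟩
    suc (v + d)            ≡⟨ +-suc v d ⟨
    v + suc d              ≡⟨ cong (λ e → v + suc e) (m+[n∸m]≡n j≤d) ⟨
    v + (suc j + (d ∸ j))  ≡⟨ +-assoc v (suc j) (d ∸ j) ⟨
    v + suc j + (d ∸ j)    ∎
    where open ≡-Reasoning

  count-sortedWithinBoundᵇ : ∀ n {k} v d → v + d + n < k →
    count k n (sortedWithinBoundᵇ (v + d) v) ≡ slackCount n d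
  count-sortedWithinBoundᵇ zero    v d _ = refl
  count-sortedWithinBoundᵇ (suc n) {k} v d bound = begin
    count k (suc n) (sortedWithinBoundᵇ (v + d) v)    ≡⟨ count-suc k n (sortedWithinBoundᵇ (v + d) v) ⟩
    ∑[ y < k ] next y                                 ≡⟨ sumBelow-window k v (suc d) window-fits below above ⟩
    next (v + 0) + ∑[ j < d ] next (v + suc j)        ≡⟨ cong₂ _+_ stay (sumBelow-cong d raise) ⟩
    slackCount n d + ∑[ j < d ] slackCount n (d ∸ j)  ∎
    where
    open ≡-Reasoning
    next : ℕ → ℕ
    next y = count k n (λ w → sortedWithinBoundᵇ (v + d) v (y ∷ w))
    window-fits : v + suc d ≤ k
    window-fits = subst (_≤ k) (sym (+-suc v d)) (≤-<-trans (m≤m+n (v + d) (suc n)) bound)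
    below : ∀ y → y < v → next y ≡ 0
    below y y<v = count-none k n (λ w → sortedWithinBoundᵇ-∷-below w y<v)
    above : ∀ y → v + suc d ≤ y → next y ≡ 0
    above y v+d<y = count-none k n (λ w → sortedWithinBoundᵇ-∷-above w (subst (_≤ y) (+-suc v d) v+d<y))
    inside : ∀ y → v ≤ y → y ≤ v + d → next y ≡ count k n (sortedWithinBoundᵇ (v + d + ascentBit v y) y)
    inside y v≤y y≤v+d = count-cong k n (λ w → sortedWithinBoundᵇ-∷-inside w v≤y y≤v+d)
    stay : next (v + 0) ≡ slackCount n d
    stay = begin
      next (v + 0)                                              ≡⟨ cong next (+-identityʳ v) ⟩
      next v                                                    ≡⟨ inside v ≤-refl (m≤m+n v d) ⟩
      count k n (sortedWithinBoundᵇ (v + d + ascentBit v v) v)  ≡⟨ cong (λ b → count k n (sortedWithinBoundᵇ b v)) unchanged ⟩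
      count k n (sortedWithinBoundᵇ (v + d) v)                  ≡⟨ count-sortedWithinBoundᵇ n v d (≤-<-trans (+-monoʳ-≤ (v + d) (n≤1+n n)) bound) ⟩
      slackCount n d                                            ∎
      where
      unchanged : v + d + ascentBit v v ≡ v + d
      unchanged = trans (cong (v + d +_) (ascentBit-refl v)) (+-identityʳ (v + d))
    raise : ∀ j → j < d → next (v + suc j) ≡ slackCount n (d ∸ j)
    raise j j<d = begin
      next (v + suc j)                                                         ≡⟨ inside (v + suc j) (m≤m+n v (suc j)) (+-monoʳ-≤ v j<d) ⟩
      count k n (sortedWithinBoundᵇ (v + d + ascentBit v (v + suc j)) (v + suc j)) ≡⟨ cong (λ b → count k n (sortedWithinBoundᵇ b (v + suc j))) raised ⟩
      count k n (sortedWithinBoundᵇ (v + suc j + (d ∸ j)) (v + suc j))         ≡⟨ count-sortedWithinBoundᵇ n (v + suc j) (d ∸ j) fits ⟩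
      slackCount n (d ∸ j)                                                     ∎
      where
      raised : v + d + ascentBit v (v + suc j) ≡ v + suc j + (d ∸ j)
      raised = trans (cong (v + d +_) (ascentBit-< (m<m+n v z<s))) (raised-bound v (<⇒≤ j<d))
      fits : v + suc j + (d ∸ j) + n < k
      fits = subst (λ b → b + n < k) (raised-bound v (<⇒≤ j<d)) (subst (_< k) (sym (+-assoc (v + d) 1 n)) bound)

  aCount10≡slackCount : ∀ p n → aCount (suc n) p pat10 ≡ slackCount n p
  aCount10≡slackCount p n = begin
    aCount (suc n) p pat10                                                   ≡⟨ count-suc k n avoiding ⟩
    ∑[ x < k ] next x                                                        ≡⟨ cong (λ m → sumBelow m next) (+-suc p n) ⟩
    next 0 + ∑[ x < p + n ] next (suc x)                                     ≡⟨ cong₂ _+_ starting-with-0 (sumBelow-zero (p + n) (λ x _ → count-none k n (λ w → refl))) ⟩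
    slackCount n p + 0                                                       ≡⟨ +-identityʳ _ ⟩
    slackCount n p                                                           ∎
    where
    open ≡-Reasoning
    k : ℕ
    k = p + suc n
    avoiding : List ℕ → Bool
    avoiding w = isPAscentᵇ p w ∧ avoidsᵇ pat10 w
    next : ℕ → ℕ
    next x = count k n (λ w → avoiding (x ∷ w))
    starting-with-0 : next 0 ≡ slackCount n p
    starting-with-0 = trans (count-cong k n (pAscent∧avoids10-0∷ p))
                            (count-sortedWithinBoundᵇ n 0 p (+-monoʳ-< p (n<1+n n)))

  aCount10≡closedForm : ∀ p n → aCount (suc n) p pat10 ≡ closedForm (suc n) p
  aCount10≡closedForm p n = trans (aCount10≡slackCount p n) (slackCount≡closedForm n p)

module GeneratingFunction where
  open Counting using (slackCount; sumBelow; aCount10≡slackCount)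
  open import Data.Nat as ℕ using (zero; suc; _∸_)
  open import Data.Integer using (ℤ; +_; -_; _+_; _*_)
  open import Data.Integer.Properties using (+-identityˡ; +-identityʳ; *-identityˡ; *-identityʳ; *-zeroʳ; pos-+)
  open import Data.Integer.Tactic.RingSolver using (solve-∀)
  open import Data.List using (_∷_; map; foldr; applyUpTo)
  open import Function using (_∘_)
  open import Relation.Binary.PropositionalEquality using (module ≡-Reasoning; _≗_; _→-setoid_; refl; sym; trans; cong; cong₂)
  import Relation.Binary.Reasoning.Setoid as SetoidReasoning

  tailˢ : FPS → FPS
  tailˢ f i = f (suc i)

  0ˢ : FPS
  0ˢ _ = + 0

  1ˢ : FPS
  1ˢ zero    = + 1
  1ˢ (suc _) = + 0

  shiftˢ : FPS → FPS
  shiftˢ f zero    = + 0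
  shiftˢ f (suc k) = f k

  infixr 7 _·ˢ_
  _·ˢ_ : ℤ → FPS → FPS
  (c ·ˢ f) i = c * f i

  oneMinusMul : ℕ → FPS → FPS
  oneMinusMul c f zero    = f 0
  oneMinusMul c f (suc k) = f (suc k) + - (+ c) * f k

  map-applyUpTo : ∀ {a b} {A : Set a} {B : Set b} (f : A → B) (g : ℕ → A) n → map f (applyUpTo g n) ≡ applyUpTo (f ∘ g) n
  map-applyUpTo f g zero    = refl
  map-applyUpTo f g (suc n) = cong (f (g 0) ∷_) (map-applyUpTo f (g ∘ suc) n)

  ⊛-suc : ∀ f g k → (f ⊛ g) (suc k) ≡ f 0 * g (suc k) + (tailˢ f ⊛ g) k
  ⊛-suc f g k = cong (λ xs → f 0 * g (suc k) + foldr _+_ (+ 0) xs)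
    (trans (map-applyUpTo (λ i → f i * g (suc k ∸ i)) suc (suc k))
           (sym (map-applyUpTo (λ i → f (suc i) * g (k ∸ i)) (λ i → i) (suc k))))

  ⊛-cong : ∀ {f f′ g g′} → f ≗ f′ → g ≗ g′ → f ⊛ g ≗ f′ ⊛ g′
  ⊛-cong f≗f′ g≗g′ zero    = cong₂ (λ a b → a * b + + 0) (f≗f′ 0) (g≗g′ 0)
  ⊛-cong {f} {f′} {g} {g′} f≗f′ g≗g′ (suc k) = begin
    (f ⊛ g) (suc k)                        ≡⟨ ⊛-suc f g k ⟩
    f 0 * g (suc k) + (tailˢ f ⊛ g) k      ≡⟨ cong₂ _+_ (cong₂ _*_ (f≗f′ 0) (g≗g′ (suc k))) (⊛-cong (f≗f′ ∘ suc) g≗g′ k) ⟩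
    f′ 0 * g′ (suc k) + (tailˢ f′ ⊛ g′) k  ≡⟨ ⊛-suc f′ g′ k ⟨
    (f′ ⊛ g′) (suc k)                      ∎
    where open ≡-Reasoning

  ⊛-congˡ : ∀ {f f′} g → f ≗ f′ → f ⊛ g ≗ f′ ⊛ g
  ⊛-congˡ g f≗f′ = ⊛-cong {g = g} f≗f′ (λ _ → refl)

  ⊛-congʳ : ∀ f {g g′} → g ≗ g′ → f ⊛ g ≗ f ⊛ g′
  ⊛-congʳ f g≗g′ = ⊛-cong {f} (λ _ → refl) g≗g′

  ⊛-zeroˡ : ∀ g → 0ˢ ⊛ g ≗ 0ˢ
  ⊛-zeroˡ g zero    = refl
  ⊛-zeroˡ g (suc k) = trans (⊛-suc 0ˢ g k) (cong (λ x → + 0 + x) (⊛-zeroˡ g k))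

  ⊛-identityˡ : ∀ g → 1ˢ ⊛ g ≗ g
  ⊛-identityˡ g zero    = trans (+-identityʳ _) (*-identityˡ (g 0))
  ⊛-identityˡ g (suc k) =
    trans (⊛-suc 1ˢ g k) (trans (cong (λ x → + 1 * g (suc k) + x) (⊛-zeroˡ g k)) (trans (+-identityʳ _) (*-identityˡ _)))

  ⊛-identityʳ : ∀ f → f ⊛ 1ˢ ≗ f
  ⊛-identityʳ f zero    = trans (+-identityʳ _) (*-identityʳ (f 0))
  ⊛-identityʳ f (suc k) =
    trans (⊛-suc f 1ˢ k) (trans (cong₂ _+_ (*-zeroʳ (f 0)) (⊛-identityʳ (tailˢ f) k)) (+-identityˡ _))

  ⊛-distribʳ-⊕ : ∀ f g h → (f ⊕ g) ⊛ h ≗ (f ⊛ h) ⊕ (g ⊛ h)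
  ⊛-distribʳ-⊕ f g h zero    = rearrange (f 0) (g 0) (h 0)
    where
    rearrange : ∀ a b c → (a + b) * c + + 0 ≡ (a * c + + 0) + (b * c + + 0)
    rearrange = solve-∀
  ⊛-distribʳ-⊕ f g h (suc k) = begin
    ((f ⊕ g) ⊛ h) (suc k)                                                   ≡⟨ ⊛-suc (f ⊕ g) h k ⟩
    (f 0 + g 0) * h (suc k) + ((tailˢ f ⊕ tailˢ g) ⊛ h) k                   ≡⟨ cong (λ x → (f 0 + g 0) * h (suc k) + x) (⊛-distribʳ-⊕ (tailˢ f) (tailˢ g) h k) ⟩
    (f 0 + g 0) * h (suc k) + ((tailˢ f ⊛ h) k + (tailˢ g ⊛ h) k)           ≡⟨ rearrange (f 0) (g 0) (h (suc k)) _ _ ⟩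
    (f 0 * h (suc k) + (tailˢ f ⊛ h) k) + (g 0 * h (suc k) + (tailˢ g ⊛ h) k) ≡⟨ cong₂ _+_ (⊛-suc f h k) (⊛-suc g h k) ⟨
    ((f ⊛ h) ⊕ (g ⊛ h)) (suc k)                                             ∎
    where
    open ≡-Reasoning
    rearrange : ∀ a b c x y → (a + b) * c + (x + y) ≡ (a * c + x) + (b * c + y)
    rearrange = solve-∀

  ⊛-scaleˡ : ∀ c f g → (c ·ˢ f) ⊛ g ≗ c ·ˢ (f ⊛ g)
  ⊛-scaleˡ c f g zero    = rearrange c (f 0) (g 0)
    where
    rearrange : ∀ a b d → a * b * d + + 0 ≡ a * (b * d + + 0)
    rearrange = solve-∀
  ⊛-scaleˡ c f g (suc k) = begin
    ((c ·ˢ f) ⊛ g) (suc k)                     ≡⟨ ⊛-suc (c ·ˢ f) g k ⟩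
    c * f 0 * g (suc k) + ((c ·ˢ tailˢ f) ⊛ g) k ≡⟨ cong (λ x → c * f 0 * g (suc k) + x) (⊛-scaleˡ c (tailˢ f) g k) ⟩
    c * f 0 * g (suc k) + c * (tailˢ f ⊛ g) k  ≡⟨ rearrange c (f 0) (g (suc k)) _ ⟩
    c * (f 0 * g (suc k) + (tailˢ f ⊛ g) k)    ≡⟨ cong (c *_) (⊛-suc f g k) ⟨
    (c ·ˢ (f ⊛ g)) (suc k)                     ∎
    where
    open ≡-Reasoning
    rearrange : ∀ a b d x → a * b * d + a * x ≡ a * (b * d + x)
    rearrange = solve-∀

  ⊛-assoc : ∀ f g h → f ⊛ (g ⊛ h) ≗ (f ⊛ g) ⊛ h
  ⊛-assoc f g h zero    = rearrange (f 0) (g 0) (h 0)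
    where
    rearrange : ∀ a b c → a * (b * c + + 0) + + 0 ≡ (a * b + + 0) * c + + 0
    rearrange = solve-∀
  ⊛-assoc f g h (suc k) = begin
    (f ⊛ (g ⊛ h)) (suc k)                                                    ≡⟨ ⊛-suc f (g ⊛ h) k ⟩
    f 0 * (g ⊛ h) (suc k) + (tailˢ f ⊛ (g ⊛ h)) k                            ≡⟨ cong₂ _+_ (cong (f 0 *_) (⊛-suc g h k)) (⊛-assoc (tailˢ f) g h k) ⟩
    f 0 * (g 0 * h (suc k) + (tailˢ g ⊛ h) k) + ((tailˢ f ⊛ g) ⊛ h) k        ≡⟨ rearrange (f 0) (g 0) (h (suc k)) _ _ ⟩
    (f ⊛ g) 0 * h (suc k) + (f 0 * (tailˢ g ⊛ h) k + ((tailˢ f ⊛ g) ⊛ h) k)  ≡⟨ cong (λ x → (f ⊛ g) 0 * h (suc k) + x) tail-product ⟨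
    (f ⊛ g) 0 * h (suc k) + (tailˢ (f ⊛ g) ⊛ h) k                            ≡⟨ ⊛-suc (f ⊛ g) h k ⟨
    ((f ⊛ g) ⊛ h) (suc k)                                                    ∎
    where
    open ≡-Reasoning
    rearrange : ∀ a b c x y → a * (b * c + x) + y ≡ (a * b + + 0) * c + (a * x + y)
    rearrange = solve-∀
    tail-product : (tailˢ (f ⊛ g) ⊛ h) k ≡ f 0 * (tailˢ g ⊛ h) k + ((tailˢ f ⊛ g) ⊛ h) k
    tail-product = begin
      (tailˢ (f ⊛ g) ⊛ h) k                                 ≡⟨ ⊛-congˡ h (⊛-suc f g) k ⟩
      (((f 0 ·ˢ tailˢ g) ⊕ (tailˢ f ⊛ g)) ⊛ h) k            ≡⟨ ⊛-distribʳ-⊕ (f 0 ·ˢ tailˢ g) (tailˢ f ⊛ g) h k ⟩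
      ((f 0 ·ˢ tailˢ g) ⊛ h) k + ((tailˢ f ⊛ g) ⊛ h) k      ≡⟨ cong (λ x → x + ((tailˢ f ⊛ g) ⊛ h) k) (⊛-scaleˡ (f 0) (tailˢ g) h k) ⟩
      f 0 * (tailˢ g ⊛ h) k + ((tailˢ f ⊛ g) ⊛ h) k         ∎

  tailˢ-oneMinus-⊛ : ∀ c f → tailˢ (oneMinus c) ⊛ f ≗ - (+ c) ·ˢ f
  tailˢ-oneMinus-⊛ c f zero    = +-identityʳ _
  tailˢ-oneMinus-⊛ c f (suc k) =
    trans (⊛-suc (tailˢ (oneMinus c)) f k) (trans (cong (λ x → - (+ c) * f (suc k) + x) (⊛-zeroˡ f k)) (+-identityʳ _))

  oneMinus-⊛ : ∀ c f → oneMinus c ⊛ f ≗ oneMinusMul c f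
  oneMinus-⊛ c f zero    = trans (+-identityʳ _) (*-identityˡ (f 0))
  oneMinus-⊛ c f (suc k) =
    trans (⊛-suc (oneMinus c) f k) (cong₂ _+_ (*-identityˡ (f (suc k))) (tailˢ-oneMinus-⊛ c f k))

  ⊛-oneMinus : ∀ c f → f ⊛ oneMinus c ≗ oneMinusMul c f
  ⊛-oneMinus c f zero          = trans (+-identityʳ _) (*-identityʳ (f 0))
  ⊛-oneMinus c f (suc zero)    =
    trans (⊛-suc f (oneMinus c) 0) (trans (cong (λ x → f 0 * - (+ c) + x) (+-identityʳ _)) (rearrange (f 0) (f 1) (- (+ c))))
    where
    rearrange : ∀ a b d → a * d + b * + 1 ≡ b + d * a
    rearrange = solve-∀
  ⊛-oneMinus c f (suc (suc k)) =
    trans (⊛-suc f (oneMinus c) (suc k)) (trans (cong₂ _+_ (*-zeroʳ (f 0)) (⊛-oneMinus c (tailˢ f) (suc k))) (+-identityˡ _))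

  oneMinus-⊛-comm : ∀ c f → oneMinus c ⊛ f ≗ f ⊛ oneMinus c
  oneMinus-⊛-comm c f k = trans (oneMinus-⊛ c f k) (sym (⊛-oneMinus c f k))

  shiftˢ-⊛ : ∀ f g → shiftˢ f ⊛ g ≗ shiftˢ (f ⊛ g)
  shiftˢ-⊛ f g zero    = refl
  shiftˢ-⊛ f g (suc k) = trans (⊛-suc (shiftˢ f) g k) (+-identityˡ _)

  shiftˢ-cong : ∀ {f g} → f ≗ g → shiftˢ f ≗ shiftˢ g
  shiftˢ-cong f≗g zero    = refl
  shiftˢ-cong f≗g (suc k) = f≗g k

  tS≗shiftˢ1ˢ : tS ≗ shiftˢ 1ˢ
  tS≗shiftˢ1ˢ zero          = refl
  tS≗shiftˢ1ˢ (suc zero)    = refl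
  tS≗shiftˢ1ˢ (suc (suc k)) = refl

  ^ˢ-zero : ∀ f → f ^ˢ 0 ≗ 1ˢ
  ^ˢ-zero f zero    = refl
  ^ˢ-zero f (suc k) = refl

  ⊕-cong : ∀ {f f′ g g′} → f ≗ f′ → g ≗ g′ → f ⊕ g ≗ f′ ⊕ g′
  ⊕-cong f≗f′ g≗g′ k = cong₂ _+_ (f≗f′ k) (g≗g′ k)

  ⊕-congʳ : ∀ f {g g′} → g ≗ g′ → f ⊕ g ≗ f ⊕ g′
  ⊕-congʳ f g≗g′ k = cong (λ x → f k + x) (g≗g′ k)

  -- The generating function

  slackSeries : ℕ → FPS
  slackSeries d m = + slackCount m d

  -- The coefficient identity is the defining recurrence of slackCount, read twice.
  oneMinusMul-slackSeries-suc : ∀ d → oneMinusMul 2 (slackSeries (suc d)) ≗ oneMinusMul 1 (slackSeries d)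
  oneMinusMul-slackSeries-suc d zero    = refl
  oneMinusMul-slackSeries-suc d (suc m) = begin
    + (a ℕ.+ (a ℕ.+ s)) + - (+ 2) * + a  ≡⟨ cong (λ x → x + - (+ 2) * + a) (trans (pos-+ a _) (cong (λ x → + a + x) (pos-+ a s))) ⟩
    + a + (+ a + + s) + - (+ 2) * + a    ≡⟨ rearrange (+ a) (+ b) (+ s) ⟩
    + b + + s + - (+ 1) * + b            ≡⟨ cong (λ x → x + - (+ 1) * + b) (pos-+ b s) ⟨
    + (b ℕ.+ s) + - (+ 1) * + b          ∎
    where
    open ≡-Reasoning
    a b s : ℕ
    a = slackCount m (suc d)
    b = slackCount m d
    s = sumBelow d (λ j → slackCount m (d ∸ j))
    rearrange : ∀ a b s → a + (a + s) + - (+ 2) * a ≡ b + s + - (+ 1) * b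
    rearrange = solve-∀

  oneMinusMul-slackSeries-zero : oneMinusMul 1 (slackSeries 0) ≗ 1ˢ
  oneMinusMul-slackSeries-zero zero    = refl
  oneMinusMul-slackSeries-zero (suc m) =
    trans (cong (λ x → x + - (+ 1) * + slackCount m 0) (pos-+ (slackCount m 0) 0)) (cancel (+ slackCount m 0))
    where
    cancel : ∀ a → a + + 0 + - (+ 1) * a ≡ + 0
    cancel = solve-∀

  slackSeries-⊛-oneMinus : ∀ d → slackSeries (suc d) ⊛ oneMinus 2 ≗ slackSeries d ⊛ oneMinus 1
  slackSeries-⊛-oneMinus d k =
    trans (⊛-oneMinus 2 (slackSeries (suc d)) k) (trans (oneMinusMul-slackSeries-suc d k) (sym (⊛-oneMinus 1 (slackSeries d) k)))

  slackSeries-⊛-power : ∀ d → slackSeries (suc d) ⊛ (oneMinus 2 ^ˢ suc d) ≗ oneMinus 1 ^ˢ d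
  slackSeries-⊛-power zero = begin
    H 1 ⊛ (P ⊛ (P ^ˢ 0))   ≈⟨ ⊛-assoc (H 1) P (P ^ˢ 0) ⟩
    (H 1 ⊛ P) ⊛ (P ^ˢ 0)   ≈⟨ ⊛-congʳ (H 1 ⊛ P) (^ˢ-zero P) ⟩
    (H 1 ⊛ P) ⊛ 1ˢ         ≈⟨ ⊛-identityʳ (H 1 ⊛ P) ⟩
    H 1 ⊛ P                ≈⟨ slackSeries-⊛-oneMinus 0 ⟩
    H 0 ⊛ Q                ≈⟨ ⊛-oneMinus 1 (H 0) ⟩
    oneMinusMul 1 (H 0)    ≈⟨ oneMinusMul-slackSeries-zero ⟩
    1ˢ                     ≈⟨ ^ˢ-zero Q ⟨
    Q ^ˢ 0                 ∎
    where
    open SetoidReasoning (ℕ →-setoid ℤ)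
    H : ℕ → FPS
    H = slackSeries
    P Q : FPS
    P = oneMinus 2
    Q = oneMinus 1
  slackSeries-⊛-power (suc d) = begin
    H (suc (suc d)) ⊛ (P ⊛ (P ^ˢ suc d))          ≈⟨ ⊛-assoc (H (suc (suc d))) P (P ^ˢ suc d) ⟩
    (H (suc (suc d)) ⊛ P) ⊛ (P ^ˢ suc d)          ≈⟨ ⊛-congˡ (P ^ˢ suc d) (slackSeries-⊛-oneMinus (suc d)) ⟩
    (H (suc d) ⊛ Q) ⊛ (P ^ˢ suc d)            ≈⟨ ⊛-assoc (H (suc d)) Q (P ^ˢ suc d) ⟨
    H (suc d) ⊛ (Q ⊛ (P ^ˢ suc d))            ≈⟨ ⊛-congʳ (H (suc d)) (oneMinus-⊛-comm 1 (P ^ˢ suc d)) ⟩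
    H (suc d) ⊛ ((P ^ˢ suc d) ⊛ Q)            ≈⟨ ⊛-assoc (H (suc d)) (P ^ˢ suc d) Q ⟩
    (H (suc d) ⊛ (P ^ˢ suc d)) ⊛ Q            ≈⟨ ⊛-congˡ Q (slackSeries-⊛-power d) ⟩
    (Q ^ˢ d) ⊛ Q                              ≈⟨ oneMinus-⊛-comm 1 (Q ^ˢ d) ⟨
    Q ^ˢ suc d                                ∎
    where
    open SetoidReasoning (ℕ →-setoid ℤ)
    H : ℕ → FPS
    H = slackSeries
    P Q : FPS
    P = oneMinus 2
    Q = oneMinus 1

  genFun≗1ˢ⊕shiftˢ : ∀ p → genFun p ≗ 1ˢ ⊕ shiftˢ (slackSeries p)
  genFun≗1ˢ⊕shiftˢ p zero    = refl
  genFun≗1ˢ⊕shiftˢ p (suc n) = trans (cong +_ (aCount10≡slackCount p n)) (sym (+-identityˡ _))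

  genFun-identity : ∀ d → genFun (suc d) ⊛ (oneMinus 2 ^ˢ suc d) ≗ (oneMinus 2 ^ˢ suc d) ⊕ (tS ⊛ (oneMinus 1 ^ˢ d))
  genFun-identity d = begin
    genFun (suc d) ⊛ (P ^ˢ suc d)                      ≈⟨ ⊛-congˡ (P ^ˢ suc d) (genFun≗1ˢ⊕shiftˢ (suc d)) ⟩
    (1ˢ ⊕ shiftˢ H) ⊛ (P ^ˢ suc d)                     ≈⟨ ⊛-distribʳ-⊕ 1ˢ (shiftˢ H) (P ^ˢ suc d) ⟩
    (1ˢ ⊛ (P ^ˢ suc d)) ⊕ (shiftˢ H ⊛ (P ^ˢ suc d))    ≈⟨ ⊕-cong (⊛-identityˡ (P ^ˢ suc d)) (shiftˢ-⊛ H (P ^ˢ suc d)) ⟩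
    (P ^ˢ suc d) ⊕ shiftˢ (H ⊛ (P ^ˢ suc d))           ≈⟨ ⊕-congʳ (P ^ˢ suc d) (shiftˢ-cong (slackSeries-⊛-power d)) ⟩
    (P ^ˢ suc d) ⊕ shiftˢ (Q ^ˢ d)                     ≈⟨ ⊕-congʳ (P ^ˢ suc d) (shiftˢ-cong (⊛-identityˡ (Q ^ˢ d))) ⟨
    (P ^ˢ suc d) ⊕ shiftˢ (1ˢ ⊛ (Q ^ˢ d))              ≈⟨ ⊕-congʳ (P ^ˢ suc d) (shiftˢ-⊛ 1ˢ (Q ^ˢ d)) ⟨
    (P ^ˢ suc d) ⊕ (shiftˢ 1ˢ ⊛ (Q ^ˢ d))              ≈⟨ ⊕-congʳ (P ^ˢ suc d) (⊛-congˡ (Q ^ˢ d) tS≗shiftˢ1ˢ) ⟨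
    (P ^ˢ suc d) ⊕ (tS ⊛ (Q ^ˢ d))                     ∎
    where
    open SetoidReasoning (ℕ →-setoid ℤ)
    H P Q : FPS
    H = slackSeries (suc d)
    P = oneMinus 2
    Q = oneMinus 1

open import Data.Nat using (suc)
open import Data.Product using (_,_)
open Counting using (aCount10≡closedForm)
open GeneratingFunction using (genFun-identity)

mainTheorem11 : (p : ℕ) → 1 ≤ p →
    ((n : ℕ) → 1 ≤ n → aCount n p pat10 ≡ closedForm n p)
    × ((k : ℕ) → (genFun p ⊛ (oneMinus 2 ^ˢ p)) k
                 ≡ ((oneMinus 2 ^ˢ p) ⊕ (tS ⊛ (oneMinus 1 ^ˢ (p ∸ 1)))) k)
mainTheorem11 (suc d) _ = (λ { (suc m) _ → aCount10≡closedForm (suc d) m }) , genFun-identity d
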